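{- Let $p$ be an odd prime and $D=\{1\leq i\leq p^2-p-1:\ \gcd(i,p)=1\}$. Then $\delta_{D,p}=\frac{1}{p-1}$.
   Context: For a prime $p$, a finite set $D$ of positive integers and $\ell\geq1$, $E_{D,p}(\ell)$ is the set of tuples $U=(u_d)_{d\in D}$ with $0\leq u_d\leq p^\ell-1$, $\sum_{d\in D}du_d\equiv 0 \pmod{p^\ell-1}$ and $\sum_{d\in D}du_d>0$. With $s_p(n)$ the sum of the base-$p$ digits of $n$ and $s_p(U)=\sum_d s_p(u_d)$, the $p$-density of $D$ is $\delta_{D,p}=\inf_{\ell\geq1}\min_{U\in E_{D,p}(\ell)}\frac{s_p(U)}{(p-1)\ell}$. -}

module Defs where

open import Data.Nat using (ℕ; zero; suc; _+_; _*_; _∸_; _^_; _≤_; _<_; _>_)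
open import Data.Nat.DivMod using (_/_; _%_)
open import Data.Nat.Divisibility using (_∣_)
open import Data.Nat.GCD using (gcd)
open import Data.Nat.Properties using (_≟_)
open import Data.Integer using (+_)
open import Data.Rational.Unnormalised using (ℚᵘ; mkℚᵘ; 0ℚᵘ) renaming (_≤_ to _≤ᵘ_; _<_ to _<ᵘ_; _+_ to _+ᵘ_)
open import Data.List using (List; length; map; upTo; filter; lookup)
open import Data.Fin using (Fin)
open import Data.Product using (Σ; _×_; ∃-syntax)

-- base-p digit sum with fuel (fuel n suffices since n / p < n for p ≥ 2, n > 0)
digitSumAux : ℕ → ℕ → ℕ → ℕ
digitSumAux zero    p n = 0
digitSumAux (suc f) zero n = 0
digitSumAux (suc f) (suc zero) n = 0
digitSumAux (suc f) (suc (suc q)) n =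
  n % suc (suc q) + digitSumAux f (suc (suc q)) (n / suc (suc q))

s : ℕ → ℕ → ℕ
s p n = digitSumAux (suc n) p n

-- A finite set D is given as a list of (distinct) positive integers;
-- a tuple U = (u_d)_{d ∈ D} is a function on positions of the list.
Tuple : List ℕ → Set
Tuple D = Fin (length D) → ℕ

sumFin : (n : ℕ) → (Fin n → ℕ) → ℕ
sumFin zero    f = 0
sumFin (suc n) f = f Fin.zero + sumFin n (λ i → f (Fin.suc i))
  where import Data.Fin as Fin

weight : (D : List ℕ) → Tuple D → ℕ
weight D U = sumFin (length D) (λ i → lookup D i * U i)

sU : ℕ → (D : List ℕ) → Tuple D → ℕ
sU p D U = sumFin (length D) (λ i → s p (U i))

InE : (D : List ℕ) → ℕ → ℕ → Tuple D → Set
InE D p ℓ U =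
  (∀ i → U i ≤ p ^ ℓ ∸ 1) × ((p ^ ℓ ∸ 1) ∣ weight D U) × (weight D U > 0)

-- a / b as an unnormalised rational, for b ≥ 1
frac : ℕ → ℕ → ℚᵘ
frac a b = mkℚᵘ (+ a) (b ∸ 1)

ratio : ℕ → ℕ → (D : List ℕ) → Tuple D → ℚᵘ
ratio p ℓ D U = frac (sU p D U) ((p ∸ 1) * ℓ)

-- δ_{D,p} = q : q is the infimum of { s_p(U)/((p-1)ℓ) : ℓ ≥ 1, U ∈ E_{D,p}(ℓ) }
-- (the inf over ℓ of the min over the finite set E(ℓ) is the inf of the union)
IsDensity : List ℕ → ℕ → ℚᵘ → Set
IsDensity D p q =
  (∀ (ℓ : ℕ) (U : Tuple D) → 1 ≤ ℓ → InE D p ℓ U → q ≤ᵘ ratio p ℓ D U)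
  × (∀ (ε : ℚᵘ) → 0ℚᵘ <ᵘ ε →
       ∃[ ℓ ] Σ (Tuple D) λ U →
         (1 ≤ ℓ) × InE D p ℓ U × (ratio p ℓ D U <ᵘ q +ᵘ ε))

Dset : ℕ → List ℕ
Dset p = filter (λ i → gcd i p ≟ 1) (map suc (upTo (p * p ∸ p ∸ 1)))

{-# OPTIONS --safe #-}
-- Let U ∈ E(ℓ), Q = p^ℓ - 1, and let W_k be the weight Σ d u_d of the tuple whose entries have their
-- ℓ base-p digits rotated by k places. Rotation is multiplication by a power of p modulo Q, so each
-- W_k = m_k Q with m_k ≥ 1, and one rotation step reads p m_{k+1} = m_k + Σ_d d (k-th digit of u_d)
-- ≤ m_k + (p² - p - 1) n_k, where n_k is the sum of the k-th digits. As p² - p - 1 + p ≤ p², this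
-- gives p^(a+1-n_k) ≤ m_k whenever p^a ≤ m_{k+1}; once around the cycle (m_ℓ = m_0) the exponent
-- gains ℓ - Σ n_k, which therefore cannot be positive: s_p(U) = Σ n_k ≥ ℓ. Equality holds at ℓ = 1
-- for the tuple with u_{p-1} = 1 and all other entries 0.
module Submission where

open import Defs
open import Data.Nat
open import Data.Nat.Properties
open import Data.Nat.DivMod
open import Data.Nat.Divisibility
open import Data.Nat.Coprimality using (Coprime; coprime-divisor)
open import Data.Nat.Primality using (Prime; prime⇒nonTrivial)
open import Data.Nat.Tactic.RingSolver using (solve-∀)
open import Algebra.Properties.CommutativeSemigroup +-commutativeSemigroup using (interchange)
open import Algebra.Properties.CommutativeSemigroup *-commutativeSemigroup using (x∙yz≈y∙xz)
open import Data.Nat.GCD using (gcd; gcd[m,n]∣m; gcd[m,n]∣n)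
open import Data.List using (List; length; lookup; map; upTo)
open import Data.List.Membership.Propositional using (_∈_)
import Data.List.Relation.Unary.Any as Any
open import Data.List.Relation.Unary.Any.Properties using (lookup-index)
open import Data.List.Membership.Propositional.Properties
  using (∈-filter⁺; ∈-filter⁻; ∈-map⁺; ∈-map⁻; ∈-upTo⁺; ∈-upTo⁻; ∈-lookup)
open import Data.Fin using (Fin; zero; suc)
import Data.Fin.Properties as Fin
open import Data.Product using (Σ; _×_; _,_; proj₁; proj₂; ∃-syntax)
open import Data.Integer as ℤ using ()
open import Data.Integer.Properties using (pos-*)
open import Data.Rational.Unnormalised using (*≤*; 0ℚᵘ)
  renaming (_≤_ to _≤ᵘ_; _<_ to _<ᵘ_; _+_ to _+ᵘ_)
import Data.Rational.Unnormalised.Properties as ℚᵘ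
open import Function using (_∘_)
open import Relation.Binary.PropositionalEquality
open import Relation.Nullary using (yes; no; contradiction)

sumTo : ℕ → (ℕ → ℕ) → ℕ
sumTo zero    f = 0
sumTo (suc L) f = f 0 + sumTo L (f ∘ suc)

sumTo-cong : ∀ L {f g : ℕ → ℕ} → (∀ k → f k ≡ g k) → sumTo L f ≡ sumTo L g
sumTo-cong zero    f≗g = refl
sumTo-cong (suc L) f≗g = cong₂ _+_ (f≗g 0) (sumTo-cong L (f≗g ∘ suc))

sumFin-cong : ∀ n {f g : Fin n → ℕ} → (∀ i → f i ≡ g i) → sumFin n f ≡ sumFin n g
sumFin-cong zero    f≗g = refl
sumFin-cong (suc n) f≗g = cong₂ _+_ (f≗g zero) (sumFin-cong n (f≗g ∘ suc))

sumFin-zero : ∀ n → sumFin n (λ _ → 0) ≡ 0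
sumFin-zero zero    = refl
sumFin-zero (suc n) = sumFin-zero n

sumFin-+ : ∀ n (f g : Fin n → ℕ) → sumFin n (λ i → f i + g i) ≡ sumFin n f + sumFin n g
sumFin-+ zero    f g = refl
sumFin-+ (suc n) f g = trans (cong (f zero + g zero +_) (sumFin-+ n (f ∘ suc) (g ∘ suc)))
                             (interchange (f zero) (g zero) _ _)

sumFin-*ˡ : ∀ n c (f : Fin n → ℕ) → sumFin n (λ i → c * f i) ≡ c * sumFin n f
sumFin-*ˡ zero    c f = sym (*-zeroʳ c)
sumFin-*ˡ (suc n) c f = trans (cong (c * f zero +_) (sumFin-*ˡ n c (f ∘ suc)))
                              (sym (*-distribˡ-+ c _ _))

sumFin-mono-≤ : ∀ n {f g : Fin n → ℕ} → (∀ i → f i ≤ g i) → sumFin n f ≤ sumFin n g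
sumFin-mono-≤ zero    f≤g = z≤n
sumFin-mono-≤ (suc n) f≤g = +-mono-≤ (f≤g zero) (sumFin-mono-≤ n (f≤g ∘ suc))

sumFin-pos : ∀ n {f g : Fin n → ℕ} → (∀ i → 0 < f i → 0 < g i) → 0 < sumFin n f → 0 < sumFin n g
sumFin-pos (suc n) {f} {g} f⇒g 0<Σf with f zero in f₀≡
... | suc _ = <-≤-trans (f⇒g zero (subst (0 <_) (sym f₀≡) z<s)) (m≤m+n _ _)
... | zero  = ≤-trans (sumFin-pos n (f⇒g ∘ suc) 0<Σf) (m≤n+m _ _)

sumFin-sumTo-comm : ∀ n L (f : Fin n → ℕ → ℕ) →
  sumFin n (λ i → sumTo L (f i)) ≡ sumTo L (λ k → sumFin n (λ i → f i k))
sumFin-sumTo-comm n zero    f = sumFin-zero n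
sumFin-sumTo-comm n (suc L) f =
  trans (sumFin-+ n (λ i → f i 0) (λ i → sumTo L (f i ∘ suc)))
        (cong (sumFin n (λ i → f i 0) +_) (sumFin-sumTo-comm n L (λ i → f i ∘ suc)))

sumFin-single : ∀ n (i : Fin n) (f : Fin n → ℕ) → (∀ j → i ≢ j → f j ≡ 0) → sumFin n f ≡ f i
sumFin-single (suc n) zero    f vanish =
  trans (cong (f zero +_) (trans (sumFin-cong n (λ j → vanish (suc j) λ ())) (sumFin-zero n)))
        (+-identityʳ _)
sumFin-single (suc n) (suc i) f vanish =
  trans (cong (_+ sumFin n (f ∘ suc)) (vanish zero λ ()))
        (sumFin-single n i (f ∘ suc) (λ j i≢j → vanish (suc j) (i≢j ∘ Fin.suc-injective)))

m*n>0⇒m>0 : ∀ m {n} → 0 < m * n → 0 < m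
m*n>0⇒m>0 m 0<m*n = >-nonZero⁻¹ m {{m*n≢0⇒m≢0 m {{>-nonZero 0<m*n}}}}

m*n>0⇒n>0 : ∀ m {n} → 0 < m * n → 0 < n
m*n>0⇒n>0 m {n} 0<m*n = >-nonZero⁻¹ n {{m*n≢0⇒n≢0 m {{>-nonZero 0<m*n}}}}

weight-cong : ∀ D {U V : Tuple D} → (∀ i → U i ≡ V i) → weight D U ≡ weight D V
weight-cong D U≗V = sumFin-cong (length D) (λ i → cong (lookup D i *_) (U≗V i))

weight-+ : ∀ D (U V : Tuple D) → weight D (λ i → U i + V i) ≡ weight D U + weight D V
weight-+ D U V = trans (sumFin-cong (length D) (λ i → *-distribˡ-+ (lookup D i) (U i) (V i)))
                       (sumFin-+ (length D) _ _)

weight-*ˡ : ∀ D c (U : Tuple D) → weight D (λ i → c * U i) ≡ c * weight D U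
weight-*ˡ D c U = trans (sumFin-cong (length D) (λ i → x∙yz≈y∙xz (lookup D i) c (U i)))
                        (sumFin-*ˡ (length D) c _)

weight≤max*sum : ∀ D M (U : Tuple D) → (∀ i → lookup D i ≤ M) →
                 weight D U ≤ M * sumFin (length D) U
weight≤max*sum D M U D≤M = subst (weight D U ≤_) (sumFin-*ˡ (length D) M U)
                                 (sumFin-mono-≤ (length D) (λ i → *-monoˡ-≤ (U i) (D≤M i)))

indicator : ∀ {n} → Fin n → Fin n → ℕ
indicator i j with i Fin.≟ j
... | yes _ = 1
... | no  _ = 0

indicator-≡ : ∀ {n} (i : Fin n) → indicator i i ≡ 1
indicator-≡ i with i Fin.≟ i
... | yes _   = refl
... | no  i≢i = contradiction refl i≢i

indicator-≢ : ∀ {n} {i j : Fin n} → i ≢ j → indicator i j ≡ 0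
indicator-≢ {i = i} {j} i≢j with i Fin.≟ j
... | yes i≡j = contradiction i≡j i≢j
... | no  _   = refl

indicator-≤1 : ∀ {n} (i j : Fin n) → indicator i j ≤ 1
indicator-≤1 i j with i Fin.≟ j
... | yes _ = ≤-refl
... | no  _ = z≤n

frac-≤ : ∀ {a b c d} → a * suc d ≤ c * suc b → frac a (suc b) ≤ᵘ frac c (suc d)
frac-≤ {a} {b} {c} {d} a*d≤c*b =
  *≤* (subst₂ ℤ._≤_ (pos-* a (suc d)) (pos-* c (suc b)) (ℤ.+≤+ a*d≤c*b))

module Base (q : ℕ) where

  p : ℕ
  p = suc (suc q)

  p^>0 : ∀ n → 0 < p ^ n
  p^>0 = m^n>0 p

  high : ℕ → ℕ → ℕ
  high zero    u = u
  high (suc k) u = high k u / p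

  digit : ℕ → ℕ → ℕ
  digit k u = high k u % p

  low : ℕ → ℕ → ℕ
  low zero    u = 0
  low (suc k) u = low k u + p ^ k * digit k u

  high-suc : ∀ k u → high k (u / p) ≡ high (suc k) u
  high-suc zero    u = refl
  high-suc (suc k) u = cong (_/ p) (high-suc k u)

  high≡digit+p*high : ∀ k u → high k u ≡ digit k u + p * high (suc k) u
  high≡digit+p*high k u =
    trans (m≡m%n+[m/n]*n (high k u) p) (cong (digit k u +_) (*-comm (high k u / p) p))

  low+p^k*high : ∀ k u → u ≡ low k u + p ^ k * high k u
  low+p^k*high zero    u = sym (*-identityˡ u)
  low+p^k*high (suc k) u = begin
    u                                                   ≡⟨ low+p^k*high k u ⟩
    low k u + p ^ k * high k u                          ≡⟨ cong (λ h → low k u + p ^ k * h)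
                                                                (high≡digit+p*high k u) ⟩
    low k u + p ^ k * (digit k u + p * high (suc k) u)  ≡⟨ shift p (low k u) (p ^ k) (digit k u)
                                                                 (high (suc k) u) ⟩
    low (suc k) u + p ^ suc k * high (suc k) u          ∎
    where
    open ≡-Reasoning
    shift : ∀ p a b c d → a + b * (c + p * d) ≡ a + b * c + p * b * d
    shift = solve-∀

  high-< : ∀ k u c → u < p ^ k * c → high k u < c
  high-< zero    u c u< = subst (u <_) (*-identityˡ c) u<
  high-< (suc k) u c u< =
    m<n*o⇒m/o<n (high-< k u (c * p) (subst (u <_) (reassoc p (p ^ k) c) u<))
    where
    reassoc : ∀ p a c → p * a * c ≡ a * (c * p)
    reassoc = solve-∀

  high≡0 : ∀ k u → u < p ^ k → high k u ≡ 0
  high≡0 k u u< = n<1⇒n≡0 (high-< k u 1 (subst (u <_) (sym (*-identityʳ (p ^ k))) u<))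

  low-full : ∀ k u → u < p ^ k → low k u ≡ u
  low-full k u u< = sym (begin
    u                           ≡⟨ low+p^k*high k u ⟩
    low k u + p ^ k * high k u  ≡⟨ cong (λ h → low k u + p ^ k * h) (high≡0 k u u<) ⟩
    low k u + p ^ k * 0         ≡⟨ cong (low k u +_) (*-zeroʳ (p ^ k)) ⟩
    low k u + 0                 ≡⟨ +-identityʳ _ ⟩
    low k u                     ∎)
    where open ≡-Reasoning

  digitSumAux-zero : ∀ fuel → digitSumAux fuel p 0 ≡ 0
  digitSumAux-zero zero       = refl
  digitSumAux-zero (suc fuel) = digitSumAux-zero fuel

  digitSumAux-fuel : ∀ f g u → u < f → u < g → digitSumAux f p u ≡ digitSumAux g p u
  digitSumAux-fuel (suc f) (suc g) zero    _         _         =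
    trans (digitSumAux-zero f) (sym (digitSumAux-zero g))
  digitSumAux-fuel (suc f) (suc g) (suc u) (s≤s u<f) (s≤s u<g) =
    cong (suc u % p +_) (digitSumAux-fuel f g (suc u / p) (<-≤-trans u/p<u u<f) (<-≤-trans u/p<u u<g))
    where
    u/p<u : suc u / p < suc u
    u/p<u = m/n<m (suc u) p (s≤s (s≤s z≤n))

  s≡%+s/ : ∀ u → s p u ≡ u % p + s p (u / p)
  s≡%+s/ zero    = refl
  s≡%+s/ (suc u) = cong (suc u % p +_)
    (digitSumAux-fuel (suc u) (suc (suc u / p)) (suc u / p) (m/n<m (suc u) p (s≤s (s≤s z≤n))) ≤-refl)

  s≡sumTo-digit+s-high : ∀ L u → s p u ≡ sumTo L (λ k → digit k u) + s p (high L u)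
  s≡sumTo-digit+s-high zero    u = refl
  s≡sumTo-digit+s-high (suc L) u = begin
    s p u
      ≡⟨ s≡%+s/ u ⟩
    u % p + s p (u / p)
      ≡⟨ cong (u % p +_) (s≡sumTo-digit+s-high L (u / p)) ⟩
    u % p + (sumTo L (λ k → digit k (u / p)) + s p (high L (u / p)))
      ≡⟨ cong₂ (λ S h → u % p + (S + s p h)) 
                (sumTo-cong L (λ k → cong (_% p) (high-suc k u))) (high-suc L u) ⟩
    u % p + (sumTo L (λ k → digit (suc k) u) + s p (high (suc L) u))
      ≡⟨ sym (+-assoc (u % p) _ _) ⟩
    sumTo (suc L) (λ k → digit k u) + s p (high (suc L) u)
      ∎
    where open ≡-Reasoning

  s≡sumTo-digit : ∀ L u → u < p ^ L → s p u ≡ sumTo L (λ k → digit k u)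
  s≡sumTo-digit L u u< = begin
    s p u                                       ≡⟨ s≡sumTo-digit+s-high L u ⟩
    sumTo L (λ k → digit k u) + s p (high L u)  ≡⟨ cong (λ h → sumTo L (λ k → digit k u) + s p h)
                                                        (high≡0 L u u<) ⟩
    sumTo L (λ k → digit k u) + 0               ≡⟨ +-identityʳ _ ⟩
    sumTo L (λ k → digit k u)                   ∎
    where open ≡-Reasoning

  -- For u < p ^ ℓ this is u with its ℓ base-p digits cyclically shifted down by k places.
  rotate : ℕ → ℕ → ℕ → ℕ
  rotate ℓ k u = high k u + low k u * p ^ (ℓ ∸ k)

  rotate-zero : ∀ ℓ u → rotate ℓ 0 u ≡ u
  rotate-zero ℓ u = +-identityʳ u

  rotate-full : ∀ ℓ u → u < p ^ ℓ → rotate ℓ ℓ u ≡ u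
  rotate-full ℓ u u< = begin
    high ℓ u + low ℓ u * p ^ (ℓ ∸ ℓ)  ≡⟨ cong₂ (λ h e → h + low ℓ u * p ^ e)
                                                (high≡0 ℓ u u<) (n∸n≡0 ℓ) ⟩
    low ℓ u * 1                       ≡⟨ *-identityʳ _ ⟩
    low ℓ u                           ≡⟨ low-full ℓ u u< ⟩
    u                                 ∎
    where open ≡-Reasoning

  rotate-pos : ∀ ℓ k u → 0 < u → 0 < rotate ℓ k u
  rotate-pos ℓ k u 0<u with high k u | low+p^k*high k u
  ... | suc _ | _  = z<s
  ... | zero  | u≡ = *-mono-≤ 0<low (p^>0 (ℓ ∸ k))
    where
    0<low : 0 < low k u
    0<low = subst (0 <_) (trans u≡ (trans (cong (low k u +_) (*-zeroʳ (p ^ k))) (+-identityʳ _))) 0<u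

  m∸n≡1+m∸[1+n] : ∀ {m n} → n < m → m ∸ n ≡ suc (m ∸ suc n)
  m∸n≡1+m∸[1+n] {suc m} {zero}  _         = refl
  m∸n≡1+m∸[1+n] {suc m} {suc n} (s≤s n<m) = m∸n≡1+m∸[1+n] n<m

  p*rotate-suc : ∀ ℓ k u → k < ℓ →
                 p * rotate ℓ (suc k) u ≡ rotate ℓ k u + (p ^ ℓ ∸ 1) * digit k u
  p*rotate-suc ℓ k u k<ℓ = begin
    p * (h + (L + p ^ k * δ) * p ^ j)        ≡⟨ expand p h L (p ^ k) (p ^ j) δ ⟩
    δ * (p ^ k * (p * p ^ j)) + (p * h + L * (p * p ^ j))
                                              ≡⟨ cong (λ z → δ * z + (p * h + L * (p * p ^ j))) (sym Q+1≡) ⟩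
    δ * (Q + 1) + (p * h + L * (p * p ^ j))   ≡⟨ regroup p h L (p ^ j) δ Q ⟩
    (δ + p * h) + L * (p * p ^ j) + Q * δ     ≡⟨ cong₂ (λ a e → a + L * p ^ e + Q * δ)
                                                       (sym (high≡digit+p*high k u)) (sym (m∸n≡1+m∸[1+n] k<ℓ)) ⟩
    rotate ℓ k u + Q * δ                      ∎
    where
    open ≡-Reasoning
    h L δ j Q : ℕ
    h = high (suc k) u
    L = low k u
    δ = digit k u
    j = ℓ ∸ suc k
    Q = p ^ ℓ ∸ 1
    Q+1≡ : Q + 1 ≡ p ^ k * (p * p ^ j)
    Q+1≡ = begin
      Q + 1                 ≡⟨ m∸n+n≡m (p^>0 ℓ) ⟩
      p ^ ℓ                 ≡⟨ cong (p ^_) (sym (m+[n∸m]≡n (<⇒≤ k<ℓ))) ⟩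
      p ^ (k + (ℓ ∸ k))     ≡⟨ ^-distribˡ-+-* p k (ℓ ∸ k) ⟩
      p ^ k * p ^ (ℓ ∸ k)   ≡⟨ cong (λ e → p ^ k * p ^ e) (m∸n≡1+m∸[1+n] k<ℓ) ⟩
      p ^ k * (p * p ^ j)   ∎
    expand : ∀ p h L a b δ →
             p * (h + (L + a * δ) * b) ≡ δ * (a * (p * b)) + (p * h + L * (p * b))
    expand = solve-∀
    regroup : ∀ p h L b δ Q →
              δ * (Q + 1) + (p * h + L * (p * b)) ≡ (δ + p * h) + L * (p * b) + Q * δ
    regroup = solve-∀

  m+m≤p*m : ∀ m → m + m ≤ p * m
  m+m≤p*m m = +-monoʳ-≤ m (m≤m+n m (q * m))

  n<p^n : ∀ n → n < p ^ n
  n<p^n zero    = z<s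
  n<p^n (suc n) = ≤-trans (s≤s (n<p^n n)) (≤-trans (+-monoˡ-≤ (p ^ n) (p^>0 n)) (m+m≤p*m (p ^ n)))

  module Descent (M : ℕ) (M+p≤p*p : M + p ≤ p * p) where

    1+n*M+P≤p^[1+n]*P : ∀ n P → p ≤ P → suc n * M + P ≤ p ^ suc n * P
    1+n*M+P≤p^[1+n]*P zero P p≤P = begin
      1 * M + P           ≡⟨ cong₂ _+_ (*-identityˡ M) (sym (m+[n∸m]≡n p≤P)) ⟩
      M + (p + (P ∸ p))   ≡⟨ sym (+-assoc M p _) ⟩
      M + p + (P ∸ p)     ≤⟨ +-mono-≤ M+p≤p*p (m≤n*m (P ∸ p) p) ⟩
      p * p + p * (P ∸ p) ≡⟨ sym (*-distribˡ-+ p p _) ⟩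
      p * (p + (P ∸ p))   ≡⟨ cong₂ _*_ (sym (*-identityʳ p)) (m+[n∸m]≡n p≤P) ⟩
      p ^ 1 * P           ∎
      where open ≤-Reasoning
    1+n*M+P≤p^[1+n]*P (suc n) P p≤P = begin
      M + suc n * M + P   ≡⟨ +-assoc M _ P ⟩
      M + X               ≤⟨ +-monoˡ-≤ X (≤-trans (m≤m+n M (n * M)) (m≤m+n _ P)) ⟩
      X + X               ≤⟨ m+m≤p*m X ⟩
      p * X               ≤⟨ *-monoʳ-≤ p (1+n*M+P≤p^[1+n]*P n P p≤P) ⟩
      p * (p ^ suc n * P) ≡⟨ sym (*-assoc p (p ^ suc n) P) ⟩
      p ^ suc (suc n) * P ∎
      where
      open ≤-Reasoning
      X : ℕ
      X = suc n * M + P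

    descent-step : ∀ a m′ m n → p ^ a ≤ m′ → p * m′ ≤ m + M * n → 1 ≤ m →
                   ∃[ x ] p ^ x ≤ m × suc a ≤ x + n
    descent-step a m′ m zero p^a≤m′ pm′≤ _ =
      suc a , ≤-trans (*-monoʳ-≤ p p^a≤m′) (subst (p * m′ ≤_) m+M*0≡m pm′≤) , m≤m+n (suc a) 0
      where
      m+M*0≡m : m + M * 0 ≡ m
      m+M*0≡m = trans (cong (m +_) (*-zeroʳ M)) (+-identityʳ m)
    descent-step a m′ m (suc n) p^a≤m′ pm′≤ 1≤m with a ≤? n
    ... | yes a≤n = 0 , 1≤m , s≤s a≤n
    ... | no  a≰n =
      suc b , +-cancelˡ-≤ (M * suc n) (p ^ suc b) m chain , ≤-reflexive (cong suc a≡b+1+n)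
      where
      b : ℕ
      b = a ∸ suc n
      1+n+b≡a : suc n + b ≡ a
      1+n+b≡a = m+[n∸m]≡n (≰⇒> a≰n)
      a≡b+1+n : a ≡ b + suc n
      a≡b+1+n = trans (sym 1+n+b≡a) (+-comm (suc n) b)
      p≤p^[1+b] : p ≤ p ^ suc b
      p≤p^[1+b] = ≤-trans (≤-reflexive (sym (*-identityʳ p))) (*-monoʳ-≤ p (p^>0 b))
      open ≤-Reasoning
      chain : M * suc n + p ^ suc b ≤ M * suc n + m
      chain = begin
        M * suc n + p ^ suc b    ≡⟨ cong (_+ p ^ suc b) (*-comm M (suc n)) ⟩
        suc n * M + p ^ suc b    ≤⟨ 1+n*M+P≤p^[1+n]*P n (p ^ suc b) p≤p^[1+b] ⟩
        p ^ suc n * p ^ suc b    ≡⟨ sym (^-distribˡ-+-* p (suc n) (suc b)) ⟩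
        p ^ (suc n + suc b)      ≡⟨ cong (p ^_) (trans (+-suc (suc n) b) (cong suc 1+n+b≡a)) ⟩
        p * p ^ a                ≤⟨ *-monoʳ-≤ p p^a≤m′ ⟩
        p * m′                   ≤⟨ pm′≤ ⟩
        m + M * suc n            ≡⟨ +-comm m _ ⟩
        M * suc n + m            ∎

    descent : ∀ L (m n : ℕ → ℕ) →
              (∀ k → k < L → p * m (suc k) ≤ m k + M * n k) → (∀ k → k < L → 1 ≤ m k) →
              ∀ a → p ^ a ≤ m L → ∃[ x ] p ^ x ≤ m 0 × a + L ≤ x + sumTo L n
    descent zero    m n _    _   a p^a≤ = a , p^a≤ , ≤-refl
    descent (suc L) m n step pos a p^a≤
      with descent L (m ∘ suc) (n ∘ suc) (λ k → step (suc k) ∘ s≤s) (λ k → pos (suc k) ∘ s≤s) a p^a≤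
    ... | x₁ , p^x₁≤ , a+L≤ with descent-step x₁ (m 1) (m 0) (n 0) p^x₁≤ (step 0 z<s) (pos 0 z<s)
    ... | x  , p^x≤  , 1+x₁≤ = x , p^x≤ , (begin
      a + suc L                   ≡⟨ +-suc a L ⟩
      suc (a + L)                 ≤⟨ s≤s a+L≤ ⟩
      suc x₁ + S                  ≤⟨ +-monoˡ-≤ S 1+x₁≤ ⟩
      x + n 0 + S                 ≡⟨ +-assoc x (n 0) S ⟩
      x + sumTo (suc L) n         ∎)
      where
      open ≤-Reasoning
      S : ℕ
      S = sumTo L (n ∘ suc)

    -- If the cycle had fewer than L digits, each turn would gain a factor p, forcing p ^ a ≤ m 0 for all a.
    cycle : ∀ L (m n : ℕ → ℕ) →
            (∀ k → k < L → p * m (suc k) ≤ m k + M * n k) → (∀ k → k < L → 1 ≤ m k) →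
            m L ≡ m 0 → L ≤ sumTo L n
    cycle zero        m n _    _   _      = z≤n
    cycle L@(suc _) m n step pos mL≡m0 =
      ≮⇒≥ λ S<L → <⇒≱ (n<p^n (m 0)) (p^a≤m0 S<L (m 0))
      where
      p^a≤m0 : sumTo L n < L → ∀ a → p ^ a ≤ m 0
      p^a≤m0 S<L zero    = pos 0 z<s
      p^a≤m0 S<L (suc a) with descent L m n step pos a (subst (p ^ a ≤_) (sym mL≡m0) (p^a≤m0 S<L a))
      ... | x , p^x≤ , a+L≤x+S =
        ≤-trans (^-monoʳ-≤ p (+-cancelʳ-< L a x (≤-<-trans a+L≤x+S (+-monoʳ-< x S<L)))) p^x≤

    module _ (D : List ℕ) (D≤M : ∀ i → lookup D i ≤ M)
             (ℓ′ : ℕ) (U : Tuple D) (U∈E : InE D p (suc ℓ′) U) where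

      private
        ℓ N Q : ℕ
        ℓ = suc ℓ′
        N = length D
        Q = p ^ ℓ ∸ 1

        U≤Q : ∀ i → U i ≤ Q
        U≤Q = proj₁ U∈E

        Q∣weight : Q ∣ weight D U
        Q∣weight = proj₁ (proj₂ U∈E)

        weight>0 : 0 < weight D U
        weight>0 = proj₂ (proj₂ U∈E)

        Q+1≡p^ℓ : Q + 1 ≡ p ^ ℓ
        Q+1≡p^ℓ = m∸n+n≡m (p^>0 ℓ)

        p≤p^ℓ : p ≤ p ^ ℓ
        p≤p^ℓ = ≤-trans (≤-reflexive (sym (*-identityʳ p))) (*-monoʳ-≤ p (p^>0 ℓ′))

        instance
          Q≢0 : NonZero Q
          Q≢0 = >-nonZero (≤-trans (s≤s z≤n) (∸-monoˡ-≤ 1 p≤p^ℓ))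

        Q-coprime-p : Coprime Q p
        Q-coprime-p {i} (i∣Q , i∣p) =
          ∣1⇒≡1 (∣m+n∣m⇒∣n (subst (i ∣_) (sym Q+1≡p^ℓ) (∣-trans i∣p (m∣m*n (p ^ ℓ′)))) i∣Q)

        U<p^ℓ : ∀ i → U i < p ^ ℓ
        U<p^ℓ i = ≤-<-trans (U≤Q i) (subst (Q <_) Q+1≡p^ℓ (m<m+n Q z<s))

        W e n : ℕ → ℕ
        W k = weight D (λ i → rotate ℓ k (U i))
        e k = weight D (λ i → digit k (U i))
        n k = sumFin N (λ i → digit k (U i))

        W-zero : W 0 ≡ weight D U
        W-zero = weight-cong D (λ i → rotate-zero ℓ (U i))

        W-full : W ℓ ≡ weight D U
        W-full = weight-cong D (λ i → rotate-full ℓ (U i) (U<p^ℓ i))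

        W>0 : ∀ k → 0 < W k
        W>0 k = sumFin-pos N (λ i d*u>0 → *-mono-≤ (m*n>0⇒m>0 (lookup D i) d*u>0)
                                                   (rotate-pos ℓ k (U i) (m*n>0⇒n>0 (lookup D i) d*u>0)))
                           weight>0

        p*W-suc : ∀ k → k < ℓ → p * W (suc k) ≡ W k + Q * e k
        p*W-suc k k<ℓ = begin
          p * W (suc k)
            ≡⟨ weight-*ˡ D p _ ⟨
          weight D (λ i → p * rotate ℓ (suc k) (U i))
            ≡⟨ weight-cong D (λ i → p*rotate-suc ℓ k (U i) k<ℓ) ⟩
          weight D (λ i → rotate ℓ k (U i) + Q * digit k (U i))
            ≡⟨ weight-+ D _ _ ⟩
          W k + weight D (λ i → Q * digit k (U i))
            ≡⟨ cong (W k +_) (weight-*ˡ D Q _) ⟩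
          W k + Q * e k
            ∎
          where open ≡-Reasoning

        Q∣W : ∀ k → k ≤ ℓ → Q ∣ W k
        Q∣W zero    _     = subst (Q ∣_) (sym W-zero) Q∣weight
        Q∣W (suc k) 1+k≤ℓ = coprime-divisor Q-coprime-p (subst (Q ∣_) (sym (p*W-suc k 1+k≤ℓ))
          (∣m∣n⇒∣m+n (Q∣W k (<⇒≤ 1+k≤ℓ)) (m∣m*n (e k))))

        m : ℕ → ℕ
        m k = W k / Q

        m*Q≡W : ∀ k → k ≤ ℓ → m k * Q ≡ W k
        m*Q≡W k k≤ℓ = m/n*n≡m (Q∣W k k≤ℓ)

        p*m-suc≤ : ∀ k → k < ℓ → p * m (suc k) ≤ m k + M * n k
        p*m-suc≤ k k<ℓ =
          ≤-trans (≤-reflexive p*m-suc≡) (+-monoʳ-≤ (m k) (weight≤max*sum D M _ D≤M))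
          where
          open ≡-Reasoning
          p*m-suc≡ : p * m (suc k) ≡ m k + e k
          p*m-suc≡ = *-cancelʳ-≡ _ _ Q (begin
            p * m (suc k) * Q      ≡⟨ *-assoc p (m (suc k)) Q ⟩
            p * (m (suc k) * Q)    ≡⟨ cong (p *_) (m*Q≡W (suc k) k<ℓ) ⟩
            p * W (suc k)          ≡⟨ p*W-suc k k<ℓ ⟩
            W k + Q * e k          ≡⟨ cong₂ _+_ (m*Q≡W k (<⇒≤ k<ℓ)) (*-comm (e k) Q) ⟨
            m k * Q + e k * Q      ≡⟨ *-distribʳ-+ Q (m k) (e k) ⟨
            (m k + e k) * Q        ∎)

        m>0 : ∀ k → k < ℓ → 1 ≤ m k
        m>0 k k<ℓ = m*n>0⇒m>0 (m k) (subst (0 <_) (sym (m*Q≡W k (<⇒≤ k<ℓ))) (W>0 k))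

        sU≡sumTo-n : sU p D U ≡ sumTo ℓ n
        sU≡sumTo-n = trans (sumFin-cong N (λ i → s≡sumTo-digit ℓ (U i) (U<p^ℓ i)))
                           (sumFin-sumTo-comm N ℓ (λ i k → digit k (U i)))

      ℓ≤sU : suc ℓ′ ≤ sU p D U
      ℓ≤sU = subst (ℓ ≤_) (sym sU≡sumTo-n)
                   (cycle ℓ m n p*m-suc≤ m>0 (cong (_/ Q) (trans W-full (sym W-zero))))

  indicator-∈E₁ : ∀ D (i : Fin (length D)) → lookup D i ≡ suc q →
                  InE D p 1 (indicator i) × sU p D (indicator i) ≡ 1
  indicator-∈E₁ D i Di≡ =
    ( (λ j → ≤-trans (indicator-≤1 i j) (s≤s z≤n))
    , subst₂ _∣_ (sym (*-identityʳ (suc q))) (sym weight≡) ∣-refl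
    , subst (0 <_) (sym weight≡) z<s ) ,
    trans (sumFin-single N i _ (λ j → cong (s p) ∘ indicator-≢)) (cong (s p) (indicator-≡ i))
    where
    N : ℕ
    N = length D
    vanish : ∀ j → i ≢ j → lookup D j * indicator i j ≡ 0
    vanish j i≢j = trans (cong (lookup D j *_) (indicator-≢ i≢j)) (*-zeroʳ (lookup D j))
    weight≡ : weight D (indicator i) ≡ suc q
    weight≡ = begin
      weight D (indicator i)      ≡⟨ sumFin-single N i _ vanish ⟩
      lookup D i * indicator i i  ≡⟨ cong (lookup D i *_) (indicator-≡ i) ⟩
      lookup D i * 1              ≡⟨ *-identityʳ _ ⟩
      lookup D i                  ≡⟨ Di≡ ⟩
      suc q                       ∎
      where open ≡-Reasoning

  isDensity-1/[p-1] : ∀ D → (∀ ℓ′ U → InE D p (suc ℓ′) U → suc ℓ′ ≤ sU p D U) →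
                      (Σ (Tuple D) λ U → InE D p 1 U × sU p D U ≡ 1) →
                      IsDensity D p (frac 1 (suc q))
  isDensity-1/[p-1] D ℓ≤sU (U₁ , U₁∈E , sU₁≡1) = lower , approx
    where
    lower : ∀ ℓ U → 1 ≤ ℓ → InE D p ℓ U → frac 1 (suc q) ≤ᵘ ratio p ℓ D U
    lower (suc ℓ′) U _ U∈E = frac-≤ (begin
      1 * (suc q * suc ℓ′)  ≡⟨ *-identityˡ _ ⟩
      suc q * suc ℓ′        ≤⟨ *-monoʳ-≤ (suc q) (ℓ≤sU ℓ′ U U∈E) ⟩
      suc q * sU p D U      ≡⟨ *-comm (suc q) _ ⟩
      sU p D U * suc q      ∎)
      where open ≤-Reasoning
    ratio₁≤ : ratio p 1 D U₁ ≤ᵘ frac 1 (suc q)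
    ratio₁≤ = frac-≤ (≤-reflexive (cong₂ _*_ sU₁≡1 (sym (*-identityʳ (suc q)))))
    approx : ∀ ε → 0ℚᵘ <ᵘ ε → ∃[ ℓ ] Σ (Tuple D) λ U →
             (1 ≤ ℓ) × InE D p ℓ U × (ratio p ℓ D U <ᵘ frac 1 (suc q) +ᵘ ε)
    approx ε ε>0 = 1 , U₁ , ≤-refl , U₁∈E ,
      ℚᵘ.≤-<-trans ratio₁≤ (ℚᵘ.<-respˡ-≃ (ℚᵘ.+-identityʳ _) (ℚᵘ.+-monoʳ-< (frac 1 (suc q)) ε>0))

  Dmax : ℕ
  Dmax = p * p ∸ p ∸ 1

  Dmax≡ : Dmax ≡ suc q + q * p
  Dmax≡ = cong (_∸ 1) (m+n∸m≡n p (suc q * p))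

  Dmax+p≤p*p : Dmax + p ≤ p * p
  Dmax+p≤p*p =
    subst (_≤ p * p) (cong (_+ p) (sym Dmax≡)) (≤-trans (n≤1+n _) (≤-reflexive (expand q)))
    where
    expand : ∀ q → 1 + (1 + q + q * (2 + q) + (2 + q)) ≡ (2 + q) * (2 + q)
    expand = solve-∀

  Dset≤Dmax : ∀ i → lookup (Dset p) i ≤ Dmax
  Dset≤Dmax i
    with ∈-map⁻ suc (proj₁ (∈-filter⁻ (λ d → gcd d p ≟ 1) {xs = map suc (upTo Dmax)} (∈-lookup i)))
  ... | d , d∈ , Di≡1+d = subst (_≤ Dmax) (sym Di≡1+d) (∈-upTo⁻ d∈)

  p-1∈Dset : suc q ∈ Dset p
  p-1∈Dset = ∈-filter⁺ (λ d → gcd d p ≟ 1) (∈-map⁺ suc (∈-upTo⁺ q<Dmax)) gcd[p-1,p]≡1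
    where
    q<Dmax : q < Dmax
    q<Dmax = subst (q <_) (sym Dmax≡) (m≤m+n (suc q) (q * p))
    gcd[p-1,p]≡1 : gcd (suc q) p ≡ 1
    gcd[p-1,p]≡1 = ∣1⇒≡1 (∣m+n∣m⇒∣n
      (subst (gcd (suc q) p ∣_) (+-comm 1 (suc q)) (gcd[m,n]∣n (suc q) p)) (gcd[m,n]∣m (suc q) p))

Dset-density : ∀ p → 1 < p → IsDensity (Dset p) p (frac 1 (p ∸ 1))
Dset-density 1 (s≤s ())
Dset-density (suc (suc q)) _ =
  isDensity-1/[p-1] (Dset p) (ℓ≤sU (Dset p) Dset≤Dmax)
    (indicator i , indicator-∈E₁ (Dset p) i (sym (lookup-index p-1∈Dset)))
  where
  open Base q
  open Descent Dmax Dmax+p≤p*p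
  i : Fin (length (Dset p))
  i = Any.index p-1∈Dset

-- Primality is used only through p ≥ 2, and oddness not at all.
proposition2p8 : (p : ℕ) → Prime p → p % 2 ≡ 1 → IsDensity (Dset p) p (frac 1 (p Data.Nat.∸ 1))
proposition2p8 p p-prime _ = Dset-density p (nonTrivial⇒n>1 p {{prime⇒nonTrivial p-prime}})
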